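{- The class $\mathbf{M}$ of combinatorial templates ordered by $\leq_{\mathbf{M}}$ has amalgamation: if $\mathbf{m}_0,\mathbf{m}_1,\mathbf{m}_2\in\mathbf{M}$ with $\mathbf{m}_0\leq_{\mathbf{M}}\mathbf{m}_1$ and $\mathbf{m}_0\leq_{\mathbf{M}}\mathbf{m}_2$, then there exist $\mathbf{m}_*\in\mathbf{M}$ and order-embeddings $f_\ell : L_{\mathbf{m}_\ell}\to L_{\mathbf{m}_*}$ ($\ell=1,2$) with $f_1\restriction L_{\mathbf{m}_0} = f_2\restriction L_{\mathbf{m}_0}$ such that $\{f_\ell[A] : A\in\mathcal{A}_{\mathbf{m}_\ell,t}\}\subseteq\mathcal{A}_{\mathbf{m}_*,f_\ell(t)}$ for all $\ell\in\{1,2\}$ and $t\in L_{\mathbf{m}_\ell}$. Consequently, $(\mathbf{M},\leq_{\mathbf{M}})$ has the joint embedding property.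
   Context: A combinatorial template $\mathbf{m}$ consists of a linear order $L_{\mathbf{m}}$ and a "memory" $\langle\mathcal{A}_{\mathbf{m},t} : t\in L_{\mathbf{m}}\rangle$, where each $\mathcal{A}_{\mathbf{m},t}$ is a family of subsets of $L_{\mathbf{m},t} = \{s\in L_{\mathbf{m}} : s<_{L_{\mathbf{m}}} t\}$ with $\varnothing\in\mathcal{A}_{\mathbf{m},t}$. $\mathbf{M}$ is the class of combinatorial templates. For $\mathbf{m}_1,\mathbf{m}_2\in\mathbf{M}$, $\mathbf{m}_1\leq_{\mathbf{M}}\mathbf{m}_2$ iff $L_{\mathbf{m}_1}\subseteq L_{\mathbf{m}_2}$ as linear orders (i.e. $L_{\mathbf{m}_1}$ is a suborder of $L_{\mathbf{m}_2}$) and $\mathcal{A}_{\mathbf{m}_1,t}\subseteq\mathcal{A}_{\mathbf{m}_2,t}$ for every $t\in L_{\mathbf{m}_1}$. The joint embedding property means: for any $\mathbf{m}_1,\mathbf{m}_2\in\mathbf{M}$ there are $\mathbf{m}_*\in\mathbf{M}$ and order-embeddings $f_\ell:L_{\mathbf{m}_\ell}\to L_{\mathbf{m}_*}$ with $\{f_\ell[A]:A\in\mathcal{A}_{\mathbf{m}_\ell,t}\}\subseteq\mathcal{A}_{\mathbf{m}_*,f_\ell(t)}$ for all $t\in L_{\mathbf{m}_\ell}$, $\ell=1,2$. -}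

module Defs where

open import Level using (Level; suc; Lift)
open import Data.Empty using (⊥)
open import Data.Product using (Σ; ∃; _×_; _,_)
open import Function using (_⇔_; _∘_)
open import Relation.Unary using (Pred; _⊆_)
open import Relation.Binary using (Rel)
open import Relation.Binary.Structures using (IsStrictTotalOrder)
open import Relation.Binary.PropositionalEquality using (_≡_)

∅ₗ : ∀ {ℓ} {A : Set ℓ} → Pred A ℓ
∅ₗ _ = Lift _ ⊥

image : ∀ {ℓ} {A C : Set ℓ} → (A → C) → Pred A ℓ → Pred C ℓ
image f B c = ∃ λ a → B a × f a ≡ c

record Template (ℓ : Level) : Set (suc (suc ℓ)) where
  field
    L        : Set ℓ
    _<_      : Rel L ℓ
    isLinear : IsStrictTotalOrder _≡_ _<_
    𝒜        : L → Pred (Pred L ℓ) (suc ℓ)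
    𝒜-below  : ∀ t A → 𝒜 t A → A ⊆ (λ s → s < t)
    ∅∈𝒜      : ∀ t → 𝒜 t ∅ₗ

open Template public

IsOrderEmbedding : ∀ {ℓ} (m n : Template ℓ) → (L m → L n) → Set ℓ
IsOrderEmbedding m n f = ∀ s t → _<_ m s t ⇔ _<_ n (f s) (f t)

RespectsMemory : ∀ {ℓ} (m n : Template ℓ) → (L m → L n) → Set (suc ℓ)
RespectsMemory m n f = ∀ t A → 𝒜 m t A → 𝒜 n (f t) (image f A)

IsTemplateEmbedding : ∀ {ℓ} (m n : Template ℓ) → (L m → L n) → Set (suc ℓ)
IsTemplateEmbedding m n f = IsOrderEmbedding m n f × RespectsMemory m n f

-- m ≤_M n: L m is a suborder of L n (witnessed by the inclusion map ι, an
-- order-embedding) and 𝒜_m(t) ⊆ 𝒜_n(t) (transported along ι).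
_≤M_ : ∀ {ℓ} → Template ℓ → Template ℓ → Set (suc ℓ)
m ≤M n = Σ (L m → L n) (IsTemplateEmbedding m n)

Amalgamation : ∀ ℓ → Set (suc (suc ℓ))
Amalgamation ℓ =
  ∀ (m₀ m₁ m₂ : Template ℓ) (p₁ : m₀ ≤M m₁) (p₂ : m₀ ≤M m₂) →
  Σ (Template ℓ) λ m* →
  Σ (L m₁ → L m*) λ f₁ → Σ (L m₂ → L m*) λ f₂ →
    IsTemplateEmbedding m₁ m* f₁ × IsTemplateEmbedding m₂ m* f₂ ×
    (∀ z → f₁ (Σ.proj₁ p₁ z) ≡ f₂ (Σ.proj₁ p₂ z))

JointEmbedding : ∀ ℓ → Set (suc (suc ℓ))
JointEmbedding ℓ =
  ∀ (m₁ m₂ : Template ℓ) →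
  Σ (Template ℓ) λ m* →
  Σ (L m₁ → L m*) λ f₁ → Σ (L m₂ → L m*) λ f₂ →
    IsTemplateEmbedding m₁ m* f₁ × IsTemplateEmbedding m₂ m* f₂

{-# OPTIONS --safe #-}
module Submission where

-- Amalgamate the underlying linear orders first: keep L₁ and add the points of
-- L₂ outside the image of L₀, placing such a point y below x ∈ L₁ exactly when
-- some z ∈ L₀ lies between them, y < z ≤ x.  Excluded middle decides both
-- membership in that image and this comparison.  The memory of the amalgam is
-- generated by ∅ and the images of the memories of m₁ and m₂.  Joint embedding
-- is amalgamation over the empty template.

open import Defs
open import Level using (Level; Lift)
open import Axiom.ExcludedMiddle using (ExcludedMiddle)
open import Data.Empty using (⊥; ⊥-elim)
open import Data.Product using (_×_; ∃-syntax; _,_)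
open import Data.Sum using (_⊎_; inj₁; inj₂)
open import Data.Sum.Properties using (inj₁-injective; inj₂-injective)
open import Data.Irrelevant using ([_])
open import Data.Refinement using (Refinement-syntax; _,_; value; value-injective)
open import Function using (_∘_; _⇔_; Equivalence; mk⇔)
open import Function.Construct.Identity using (⇔-id)
open import Function.Construct.Symmetry using (⇔-sym)
open import Function.Construct.Composition using (_⇔-∘_)
open import Function.Definitions using (Injective)
open import Relation.Nullary using (¬_; Dec; yes; no)
open import Relation.Unary using (Pred; _⊆_)
open import Relation.Binary using (Rel)
open import Relation.Binary.Definitions
  using (Transitive; Irreflexive; Trichotomous; Tri; tri<; tri≈; tri>)
open import Relation.Binary.Structures using (IsStrictTotalOrder)
open import Relation.Binary.Consequences using (tri⇒irr)
open import Relation.Binary.Construct.Closure.Reflexive using (ReflClosure; refl; [_])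
open import Relation.Binary.Construct.Closure.Reflexive.Properties using (=[]⇒; toSum)
open import Relation.Binary.PropositionalEquality
  using (_≡_; refl; sym; cong; isEquivalence; resp₂)

open Equivalence using (to; from)

private
  variable
    a b ℓ ℓ₁ ℓ₂ : Level
    A B : Set a

IsStrictOrderEmbedding : Rel A ℓ₁ → Rel B ℓ₂ → (A → B) → Set _
IsStrictOrderEmbedding _<A_ _<B_ f = ∀ s t → s <A t ⇔ f s <B f t

trans∧tri⇒isStrictTotalOrder : {_<_ : Rel A ℓ} →
  Transitive _<_ → Trichotomous _≡_ _<_ → IsStrictTotalOrder _≡_ _<_
trans∧tri⇒isStrictTotalOrder {_<_ = _<_} <-trans compare = record
  { isStrictPartialOrder = record
    { isEquivalence = isEquivalence
    ; irrefl        = tri⇒irr compare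
    ; trans         = <-trans
    ; <-resp-≈      = resp₂ _<_
    }
  ; compare = compare
  }

Tri-cong-≡ : ∀ {P : Set ℓ₁} {Q : Set ℓ₂} {x y : A} {x′ y′ : B} →
  (x ≡ y → x′ ≡ y′) → (x′ ≡ y′ → x ≡ y) → Tri P (x ≡ y) Q → Tri P (x′ ≡ y′) Q
Tri-cong-≡ ⇒ ⇐ (tri< p x≢y ¬q) = tri< p (x≢y ∘ ⇐) ¬q
Tri-cong-≡ ⇒ ⇐ (tri≈ ¬p x≡y ¬q) = tri≈ ¬p (⇒ x≡y) ¬q
Tri-cong-≡ ⇒ ⇐ (tri> ¬p x≢y q) = tri> ¬p (x≢y ∘ ⇐) q

module _ {_<_ : Rel A ℓ} (<-trans : Transitive _<_) {x y z : A} where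

  <-≤-trans : x < y → ReflClosure _<_ y z → x < z
  <-≤-trans x<y refl      = x<y
  <-≤-trans x<y [ y<z ]   = <-trans x<y y<z

  ≤-<-trans : ReflClosure _<_ x y → y < z → x < z
  ≤-<-trans refl y<z      = y<z
  ≤-<-trans [ x<y ] y<z   = <-trans x<y y<z

module _ {_<A_ : Rel A ℓ₁} {_<B_ : Rel B ℓ₂} {f : A → B}
         (compareA : Trichotomous _≡_ _<A_) (irreflB : Irreflexive _≡_ _<B_)
         (f-embedding : IsStrictOrderEmbedding _<A_ _<B_ f) where

  embedding-injective : Injective _≡_ _≡_ f
  embedding-injective {s} {t} fs≡ft with compareA s t
  ... | tri< s<t _ _ = ⊥-elim (irreflB fs≡ft (to (f-embedding s t) s<t))
  ... | tri≈ _ s≡t _ = s≡t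
  ... | tri> _ _ t<s = ⊥-elim (irreflB (sym fs≡ft) (to (f-embedding t s) t<s))

  embedding-reflects-≤ : ∀ {s t} → ReflClosure _<B_ (f s) (f t) → ReflClosure _<A_ s t
  embedding-reflects-≤ {s} {t} fs≤ft with toSum fs≤ft
  ... | inj₁ fs≡ft rewrite embedding-injective fs≡ft = refl
  ... | inj₂ fs<ft = [ from (f-embedding s t) fs<ft ]

module OrderAmalgamation
  (lem : ExcludedMiddle ℓ)
  {A₀ A₁ A₂ : Set ℓ} {_<₀_ : Rel A₀ ℓ} {_<₁_ : Rel A₁ ℓ} {_<₂_ : Rel A₂ ℓ}
  (linear₀ : IsStrictTotalOrder _≡_ _<₀_)
  (linear₁ : IsStrictTotalOrder _≡_ _<₁_)
  (linear₂ : IsStrictTotalOrder _≡_ _<₂_)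
  {ι₁ : A₀ → A₁} {ι₂ : A₀ → A₂}
  (ι₁-embedding : IsStrictOrderEmbedding _<₀_ _<₁_ ι₁)
  (ι₂-embedding : IsStrictOrderEmbedding _<₀_ _<₂_ ι₂)
  where

  private
    module O₀ = IsStrictTotalOrder linear₀
    module O₁ = IsStrictTotalOrder linear₁
    module O₂ = IsStrictTotalOrder linear₂

  _≤₁_ : Rel A₁ ℓ
  _≤₁_ = ReflClosure _<₁_

  InImage : A₂ → Set ℓ
  InImage y = ∃[ z ] ι₂ z ≡ y

  _≺_ : A₂ → A₁ → Set ℓ
  y ≺ x = ∃[ z ] y <₂ ι₂ z × ι₁ z ≤₁ x

  ≺-<₁-trans : ∀ {y x x′} → y ≺ x → x <₁ x′ → y ≺ x′
  ≺-<₁-trans (z , y<z , z≤x) x<x′ = z , y<z , [ ≤-<-trans O₁.trans z≤x x<x′ ]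

  <₂-≺-trans : ∀ {y′ y x} → y′ <₂ y → y ≺ x → y′ ≺ x
  <₂-≺-trans y′<y (z , y<z , z≤x) = z , O₂.trans y′<y y<z , z≤x

  ≺ι₁⇔<₂ι₂ : ∀ {y w} → y ≺ ι₁ w ⇔ y <₂ ι₂ w
  ≺ι₁⇔<₂ι₂ {y} {w} = mk⇔ below (λ y<w → w , y<w , refl)
    where
    ι₁≤⇒ι₂≤ : ∀ {z w} → ι₁ z ≤₁ ι₁ w → ReflClosure _<₂_ (ι₂ z) (ι₂ w)
    ι₁≤⇒ι₂≤ = =[]⇒ (to (ι₂-embedding _ _))
                ∘ embedding-reflects-≤ O₀.compare O₁.irrefl ι₁-embedding

    below : y ≺ ι₁ w → y <₂ ι₂ w
    below (z , y<z , z≤w) = <-≤-trans O₂.trans y<z (ι₁≤⇒ι₂≤ z≤w)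

  ¬≺-≺⇒<₁ : ∀ {y x x′} → ¬ y ≺ x → y ≺ x′ → x <₁ x′
  ¬≺-≺⇒<₁ {x = x} ¬y≺x (z , y<z , z≤x′) with O₁.compare x (ι₁ z)
  ... | tri< x<z _ _ = <-≤-trans O₁.trans x<z z≤x′
  ... | tri≈ _ refl _ = ⊥-elim (¬y≺x (z , y<z , refl))
  ... | tri> _ _ z<x = ⊥-elim (¬y≺x (z , y<z , [ z<x ]))

  ≺-¬≺⇒<₂ : ∀ {y y′ x} → y ≺ x → ¬ y′ ≺ x → y <₂ y′
  ≺-¬≺⇒<₂ {y} {y′} y≺x ¬y′≺x with O₂.compare y y′
  ... | tri< y<y′ _ _ = y<y′
  ... | tri≈ _ refl _ = ⊥-elim (¬y′≺x y≺x)
  ... | tri> _ _ y′<y = ⊥-elim (¬y′≺x (<₂-≺-trans y′<y y≺x))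

  New : Set ℓ
  New = [ y ∈ A₂ ∣ ¬ InImage y ]

  Carrier : Set ℓ
  Carrier = A₁ ⊎ New

  _<*_ : Rel Carrier ℓ
  inj₁ x <* inj₁ x′ = x <₁ x′
  inj₁ x <* inj₂ v  = ¬ value v ≺ x
  inj₂ u <* inj₁ x  = value u ≺ x
  inj₂ u <* inj₂ v  = value u <₂ value v

  <*-trans : Transitive _<*_
  <*-trans {inj₁ _} {inj₁ _} {inj₁ _} = O₁.trans
  <*-trans {inj₁ _} {inj₁ _} {inj₂ _} x<x′ ¬v≺x′ v≺x = ¬v≺x′ (≺-<₁-trans v≺x x<x′)
  <*-trans {inj₁ _} {inj₂ _} {inj₁ _} = ¬≺-≺⇒<₁
  <*-trans {inj₁ _} {inj₂ _} {inj₂ _} ¬u≺x u<v v≺x = ¬u≺x (<₂-≺-trans u<v v≺x)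
  <*-trans {inj₂ _} {inj₁ _} {inj₁ _} = ≺-<₁-trans
  <*-trans {inj₂ _} {inj₁ _} {inj₂ _} = ≺-¬≺⇒<₂
  <*-trans {inj₂ _} {inj₂ _} {inj₁ _} = <₂-≺-trans
  <*-trans {inj₂ _} {inj₂ _} {inj₂ _} = O₂.trans

  <*-compare : Trichotomous _≡_ _<*_
  <*-compare (inj₁ x) (inj₁ x′) = Tri-cong-≡ (cong inj₁) inj₁-injective (O₁.compare x x′)
  <*-compare (inj₂ u) (inj₂ v)  =
    Tri-cong-≡ (cong inj₂ ∘ value-injective) (cong value ∘ inj₂-injective)
               (O₂.compare (value u) (value v))
  <*-compare (inj₁ x) (inj₂ v) with lem {value v ≺ x}
  ... | yes v≺x = tri> (λ ¬v≺x → ¬v≺x v≺x) (λ ()) v≺x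
  ... | no ¬v≺x = tri< ¬v≺x (λ ()) ¬v≺x
  <*-compare (inj₂ u) (inj₁ x) with lem {value u ≺ x}
  ... | yes u≺x = tri< u≺x (λ ()) (λ ¬u≺x → ¬u≺x u≺x)
  ... | no ¬u≺x = tri> ¬u≺x (λ ()) ¬u≺x

  <*-isStrictTotalOrder : IsStrictTotalOrder _≡_ _<*_
  <*-isStrictTotalOrder =
    trans∧tri⇒isStrictTotalOrder (λ {i j k} → <*-trans {i} {j} {k}) <*-compare

  f₁ : A₁ → Carrier
  f₁ = inj₁

  embed₂ : (y : A₂) → Dec (InImage y) → Carrier
  embed₂ y (yes (z , _)) = inj₁ (ι₁ z)
  embed₂ y (no y∉ι₂)     = inj₂ (y , [ y∉ι₂ ])

  f₂ : A₂ → Carrier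
  f₂ y = embed₂ y lem

  f₁-embedding : IsStrictOrderEmbedding _<₁_ _<*_ f₁
  f₁-embedding _ _ = ⇔-id _

  ι₂<₂new⇔¬≺ι₁ : ∀ {z y} → ¬ InImage y → ι₂ z <₂ y ⇔ (¬ y ≺ ι₁ z)
  ι₂<₂new⇔¬≺ι₁ {z} {y} y∉ι₂ = mk⇔ (λ z<y y≺z → O₂.asym z<y (to ≺ι₁⇔<₂ι₂ y≺z)) above
    where
    above : ¬ y ≺ ι₁ z → ι₂ z <₂ y
    above ¬y≺z with O₂.compare (ι₂ z) y
    ... | tri< z<y _ _ = z<y
    ... | tri≈ _ z≡y _ = ⊥-elim (y∉ι₂ (z , z≡y))
    ... | tri> _ _ y<z = ⊥-elim (¬y≺z (from ≺ι₁⇔<₂ι₂ y<z))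

  embed₂-embedding : ∀ s t (s? : Dec (InImage s)) (t? : Dec (InImage t)) →
                     s <₂ t ⇔ embed₂ s s? <* embed₂ t t?
  embed₂-embedding _ _ (yes (z , refl)) (yes (w , refl)) =
    ι₁-embedding z w ⇔-∘ ⇔-sym (ι₂-embedding z w)
  embed₂-embedding _ _ (yes (z , refl)) (no t∉ι₂)       = ι₂<₂new⇔¬≺ι₁ t∉ι₂
  embed₂-embedding _ _ (no _)           (yes (w , refl)) = ⇔-sym ≺ι₁⇔<₂ι₂
  embed₂-embedding _ _ (no _)           (no _)           = ⇔-id _

  f₂-embedding : IsStrictOrderEmbedding _<₂_ _<*_ f₂
  f₂-embedding s t = embed₂-embedding s t lem lem

  f₁∘ι₁≗f₂∘ι₂ : ∀ z → f₁ (ι₁ z) ≡ f₂ (ι₂ z)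
  f₁∘ι₁≗f₂∘ι₂ z with lem {InImage (ι₂ z)}
  ... | yes (w , ι₂w≡ι₂z) =
    cong (inj₁ ∘ ι₁) (embedding-injective O₀.compare O₂.irrefl ι₂-embedding (sym ι₂w≡ι₂z))
  ... | no ι₂z∉ι₂ = ⊥-elim (ι₂z∉ι₂ (z , refl))

module _ {X : Set ℓ} {_<X_ : Rel X ℓ} where

  push𝒜 : (m : Template ℓ) → (L m → X) → X → Pred (Pred X ℓ) (Level.suc ℓ)
  push𝒜 m f u B = ∃[ t ] ∃[ A ] 𝒜 m t A × f t ≡ u × B ≡ image f A

  push𝒜-below : ∀ (m : Template ℓ) {f : L m → X} →
    (∀ {s t} → _<_ m s t → f s <X f t) → ∀ u B → push𝒜 m f u B → B ⊆ (_<X u)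
  push𝒜-below m f-monotone _ _ (t , A , A∈𝒜t , refl , refl) (s , s∈A , refl) =
    f-monotone (𝒜-below m t A A∈𝒜t s∈A)

  module JointImage (linear : IsStrictTotalOrder _≡_ _<X_)
    (m₁ m₂ : Template ℓ) {f₁ : L m₁ → X} {f₂ : L m₂ → X}
    (f₁-embedding : IsStrictOrderEmbedding (_<_ m₁) _<X_ f₁)
    (f₂-embedding : IsStrictOrderEmbedding (_<_ m₂) _<X_ f₂)
    where

    𝒜* : X → Pred (Pred X ℓ) (Level.suc ℓ)
    𝒜* u B = B ≡ ∅ₗ ⊎ push𝒜 m₁ f₁ u B ⊎ push𝒜 m₂ f₂ u B

    𝒜*-below : ∀ u B → 𝒜* u B → B ⊆ (_<X u)
    𝒜*-below u B (inj₁ refl)        ()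
    𝒜*-below u B (inj₂ (inj₁ B∈𝒜₁)) = push𝒜-below m₁ (to (f₁-embedding _ _)) u B B∈𝒜₁
    𝒜*-below u B (inj₂ (inj₂ B∈𝒜₂)) = push𝒜-below m₂ (to (f₂-embedding _ _)) u B B∈𝒜₂

    m* : Template ℓ
    m* = record
      { L        = X
      ; _<_      = _<X_
      ; isLinear = linear
      ; 𝒜        = 𝒜*
      ; 𝒜-below  = 𝒜*-below
      ; ∅∈𝒜      = λ _ → inj₁ refl
      }

    f₁-templateEmbedding : IsTemplateEmbedding m₁ m* f₁
    f₁-templateEmbedding =
      f₁-embedding , λ t A A∈𝒜t → inj₂ (inj₁ (t , A , A∈𝒜t , refl , refl))

    f₂-templateEmbedding : IsTemplateEmbedding m₂ m* f₂
    f₂-templateEmbedding =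
      f₂-embedding , λ t A A∈𝒜t → inj₂ (inj₂ (t , A , A∈𝒜t , refl , refl))

amalgamation : ExcludedMiddle ℓ → Amalgamation ℓ
amalgamation lem m₀ m₁ m₂ (ι₁ , ι₁-embedding , _) (ι₂ , ι₂-embedding , _) =
  m* , f₁ , f₂ , f₁-templateEmbedding , f₂-templateEmbedding , f₁∘ι₁≗f₂∘ι₂
  where
  open OrderAmalgamation lem (isLinear m₀) (isLinear m₁) (isLinear m₂)
                              ι₁-embedding ι₂-embedding
  open JointImage <*-isStrictTotalOrder m₁ m₂ {f₁} {f₂} f₁-embedding f₂-embedding

emptyTemplate : Template ℓ
emptyTemplate {ℓ} = record
  { L        = Lift ℓ ⊥
  ; _<_      = λ _ _ → Lift ℓ ⊥
  ; isLinear = trans∧tri⇒isStrictTotalOrder (λ ()) (λ ())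
  ; 𝒜        = λ ()
  ; 𝒜-below  = λ ()
  ; ∅∈𝒜      = λ ()
  }

emptyTemplate-≤M : (m : Template ℓ) → emptyTemplate ≤M m
emptyTemplate-≤M m = (λ ()) , (λ ()) , (λ ())

amalgamation⇒jointEmbedding : Amalgamation ℓ → JointEmbedding ℓ
amalgamation⇒jointEmbedding amalgamate m₁ m₂
  with amalgamate emptyTemplate m₁ m₂ (emptyTemplate-≤M m₁) (emptyTemplate-≤M m₂)
... | m* , f₁ , f₂ , f₁-embedding , f₂-embedding , _ =
  m* , f₁ , f₂ , f₁-embedding , f₂-embedding

claim1p12 : ∀ {ℓ : Level} → ExcludedMiddle ℓ → Amalgamation ℓ × JointEmbedding ℓ
claim1p12 lem = amalgamation lem , amalgamation⇒jointEmbedding (amalgamation lem)
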